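{- Let $R \subseteq \mathbb{R}^m$ and $S \subseteq \mathbb{R}^n$ be polytopes such that $0 \notin \operatorname{aff}(R)$ and $0 \notin \operatorname{aff}(S)$. Then $\varphi$ is injective on $\operatorname{aff}(R*S)$. In particular, $\varphi$ is injective on $R*S$, and therefore $R*S \cong \varphi(R*S)$.
   Context: Let $\varphi : \mathbb{R}^{m+n+1} \to \mathbb{R}^{m+n}$, $(x,y,z) \mapsto (x,y)$. For polytopes $R \subseteq \mathbb{R}^m$ and $S \subseteq \mathbb{R}^n$ with vertex sets $\{v_1,\dots,v_s\}$ and $\{w_1,\dots,w_r\}$, the join is realized as $R * S = \operatorname{conv}((v_1,0,0),\dots,(v_s,0,0),(0,w_1,1),\dots,(0,w_r,1)) \subseteq \mathbb{R}^{m+n+1}$. $\operatorname{aff}$ denotes affine hull. -}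

module Defs where

open import Level using (Level; _⊔_) renaming (suc to lsuc)
open import Data.Nat.Base renaming (_+_ to _+ℕ_) using (ℕ)
open import Data.Fin.Base using (Fin)
open import Data.Product.Base using (Σ; ∃; _×_; _,_)
open import Relation.Binary.Core using (Rel)
open import Relation.Binary.Structures using (IsTotalOrder)
open import Relation.Nullary.Negation using (¬_)
open import Algebra.Apartness.Bundles using (HeytingField)
open import Data.Vec.Functional as V using (Vector)

-- An ordered (Heyting) field: the scalars.  The real numbers ℝ are an
-- instance (with x # y meaning x ≠ y and the usual order).
record OrderedHeytingField c ℓ₁ ℓ₂ ℓ₃ : Set (lsuc (c ⊔ ℓ₁ ⊔ ℓ₂ ⊔ ℓ₃)) where
  field
    heytingField : HeytingField c ℓ₁ ℓ₂
  open HeytingField heytingField public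
  infix 4 _≤_
  field
    _≤_          : Rel Carrier ℓ₃
    isTotalOrder : IsTotalOrder _≈_ _≤_
    +-monoˡ-≤    : ∀ {x y} z → x ≤ y → (x + z) ≤ (y + z)
    *-nonneg     : ∀ {x y} → 0# ≤ x → 0# ≤ y → 0# ≤ (x * y)

module Geometry {c ℓ₁ ℓ₂ ℓ₃} (F : OrderedHeytingField c ℓ₁ ℓ₂ ℓ₃) where
  open OrderedHeytingField F

  Pt : ℕ → Set c
  Pt k = Vector Carrier k

  _≋_ : ∀ {k} → Pt k → Pt k → Set ℓ₁
  p ≋ q = ∀ i → p i ≈ q i

  0v : ∀ {k} → Pt k
  0v = V.replicate _ 0#

  ∑ : ∀ {k} → Vector Carrier k → Carrier
  ∑ = V.foldr _+_ 0#

  lincomb : ∀ {s k} → Vector Carrier s → Vector (Pt k) s → Pt k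
  lincomb λs p j = ∑ (λ i → λs i * p i j)

  _∈aff_ : ∀ {s k} → Pt k → Vector (Pt k) s → Set (c ⊔ ℓ₁)
  x ∈aff p = Σ (Vector Carrier _) λ λs → (∑ λs ≈ 1#) × (x ≋ lincomb λs p)

  _∈conv_ : ∀ {s k} → Pt k → Vector (Pt k) s → Set (c ⊔ ℓ₁ ⊔ ℓ₃)
  x ∈conv p = Σ (Vector Carrier _) λ λs →
                (∀ i → 0# ≤ λs i) × (∑ λs ≈ 1#) × (x ≋ lincomb λs p)

  embL : ∀ {m} n → Pt m → Pt (m +ℕ n +ℕ 1)
  embL n v = (v V.++ V.replicate n 0#) V.++ V.replicate 1 0#

  embR : ∀ m {n} → Pt n → Pt (m +ℕ n +ℕ 1)
  embR m w = (V.replicate m 0# V.++ w) V.++ V.replicate 1 1#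

  -- vertex family of the join  R * S  (R = conv v, S = conv w)
  joinVerts : ∀ {m n s r} → Vector (Pt m) s → Vector (Pt n) r
            → Vector (Pt (m +ℕ n +ℕ 1)) (s +ℕ r)
  joinVerts {m} {n} v w = V.map (embL n) v V.++ V.map (embR m) w

  φ : ∀ m n → Pt (m +ℕ n +ℕ 1) → Pt (m +ℕ n)
  φ m n = V.take (m +ℕ n)

  InjectiveOn : ∀ {a b ℓ} → (A : Pt a → Set ℓ) → (Pt a → Pt b) → Set (c ⊔ ℓ₁ ⊔ ℓ)
  InjectiveOn A f = ∀ {p q} → A p → A q → f p ≋ f q → p ≋ q

-- A point of aff(R * S) is  Σ λᵢ (vᵢ,0,0) + Σ μₖ (0,wₖ,1)  with  Σλ + Σμ = 1,
-- so its last coordinate is  Σμ = 1 − Σλ.  Two such points with the same image under φ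
-- have  Σ λᵢ vᵢ = Σ λ'ᵢ vᵢ.  If  Σλ ≠ Σλ'  then rescaling  λ − λ'  by
-- (Σλ − Σλ')⁻¹  writes 0 as an affine combination of the vertices of R, which
-- is excluded; hence  Σλ = Σλ'  and the last coordinates agree as well.
module Submission where

open import Defs
open import Data.Nat.Base using (ℕ; zero; suc) renaming (_+_ to _+ℕ_)
open import Data.Fin.Base using (Fin; zero; suc; _↑ˡ_; _↑ʳ_; splitAt; join)
open import Data.Fin.Properties using (join-splitAt)
open import Data.Sum.Base using (inj₁; inj₂)
open import Data.Product.Base using (_×_; _,_; proj₁)
open import Data.Vec.Functional using (Vector; take; drop; replicate; map; _++_)
open import Data.Vec.Functional.Properties using (lookup-++ˡ; lookup-++ʳ)
import Relation.Binary.PropositionalEquality as ≡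
open import Relation.Nullary.Negation using (¬_)
import Algebra.Properties.Group as GroupProperties
import Algebra.Properties.Ring as RingProperties
import Algebra.Properties.Semiring.Sum as SemiringSum
open import Algebra.Bundles using (CommutativeRing)
import Relation.Binary.Reasoning.Setoid as SetoidReasoning

module JoinProjection {c ℓ₁ ℓ₂ ℓ₃} (F : OrderedHeytingField c ℓ₁ ℓ₂ ℓ₃) where
  open OrderedHeytingField F hiding (zero)
  open Geometry F
  open SetoidReasoning setoid

  commutativeRing : CommutativeRing c ℓ₁
  commutativeRing = record { isCommutativeRing = isCommutativeRing }

  open SemiringSum (CommutativeRing.semiring commutativeRing)
    using (sum-cong-≋; ∑-distrib-+; *-distribˡ-sum; *-distribʳ-sum)
  open RingProperties (CommutativeRing.ring commutativeRing)
    using (-1*x≈-x; [y-z]x≈yx-zx)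
  open GroupProperties (CommutativeRing.+-group commutativeRing) using (x≈y⇒x∙y⁻¹≈ε; ∙-cancelˡ)
  open import Algebra.Definitions _≈_ using (Invertible)

  ∑-++ : ∀ s {r} (f : Vector Carrier (s +ℕ r)) → ∑ f ≈ ∑ (take s f) + ∑ (drop s f)
  ∑-++ zero    f = sym (+-identityˡ _)
  ∑-++ (suc s) f = trans (+-congˡ (∑-++ s (λ i → f (suc i)))) (sym (+-assoc _ _ _))

  ∑-neg : ∀ {k} (f : Vector Carrier k) → ∑ (λ i → - f i) ≈ - ∑ f
  ∑-neg f = begin
    ∑ (λ i → - f i)       ≈⟨ sum-cong-≋ (λ i → sym (-1*x≈-x (f i))) ⟩
    ∑ (λ i → - 1# * f i)  ≈⟨ sym (*-distribˡ-sum (- 1#) f) ⟩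
    - 1# * ∑ f            ≈⟨ -1*x≈-x (∑ f) ⟩
    - ∑ f                 ∎

  ∑-scaled-difference : ∀ {k} u (f g : Vector Carrier k) →
                        ∑ (λ i → u * (f i - g i)) ≈ u * (∑ f - ∑ g)
  ∑-scaled-difference u f g = begin
    ∑ (λ i → u * (f i - g i))  ≈⟨ sym (*-distribˡ-sum u (λ i → f i - g i)) ⟩
    u * ∑ (λ i → f i - g i)    ≈⟨ *-congˡ (∑-distrib-+ f (λ i → - g i)) ⟩
    u * (∑ f + ∑ (λ i → - g i)) ≈⟨ *-congˡ (+-congˡ (∑-neg g)) ⟩
    u * (∑ f - ∑ g)            ∎

  lincomb-const : ∀ {s k} (λs : Vector Carrier s) (p : Vector (Pt k) s) j x →
                  (∀ i → p i j ≈ x) → lincomb λs p j ≈ ∑ λs * x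
  lincomb-const λs p j x px = begin
    lincomb λs p j           ≈⟨ sum-cong-≋ (λ i → *-congˡ (px i)) ⟩
    ∑ (λ i → λs i * x)       ≈⟨ sym (*-distribʳ-sum x λs) ⟩
    ∑ λs * x                 ∎

  lincomb-++ : ∀ {s r k} (λs : Vector Carrier (s +ℕ r))
               (p : Vector (Pt k) s) (q : Vector (Pt k) r) j →
               lincomb λs (p ++ q) j ≈ lincomb (take s λs) p j + lincomb (drop s λs) q j
  lincomb-++ {s} λs p q j = trans (∑-++ s _) (+-cong
    (sum-cong-≋ (λ i → *-congˡ (reflexive (≡.cong (λ x → x j) (lookup-++ˡ p q i)))))
    (sum-cong-≋ (λ i → *-congˡ (reflexive (≡.cong (λ x → x j) (lookup-++ʳ p q i))))))

  lincomb-scaled-difference : ∀ {s k} u (λs μs : Vector Carrier s) (p : Vector (Pt k) s) j →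
    lincomb (λ i → u * (λs i - μs i)) p j ≈ u * (lincomb λs p j - lincomb μs p j)
  lincomb-scaled-difference u λs μs p j = trans
    (sum-cong-≋ (λ i → trans (*-assoc u _ (p i j)) (*-congˡ ([y-z]x≈yx-zx (p i j) (λs i) (μs i)))))
    (∑-scaled-difference u (λ i → λs i * p i j) (λ i → μs i * p i j))

  0∉aff⇒lincomb-determines-∑ : ∀ {s k} {p : Vector (Pt k) s} (λs μs : Vector Carrier s) →
    ¬ (0v ∈aff p) → (∀ j → lincomb λs p j ≈ lincomb μs p j) → ∑ λs ≈ ∑ μs
  0∉aff⇒lincomb-determines-∑ {p = p} λs μs 0∉aff same =
    proj₁ (tight (∑ λs) (∑ μs)) (λ λ#μ → 0∉aff (0∈aff (#⇒invertible λ#μ)))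
    where
    0∈aff : Invertible 1# _*_ (∑ λs - ∑ μs) → 0v ∈aff p
    0∈aff (u , u[λ-μ]≈1 , _) =
      (λ i → u * (λs i - μs i)) ,
      trans (∑-scaled-difference u λs μs) u[λ-μ]≈1 ,
      λ j → sym (begin
        lincomb (λ i → u * (λs i - μs i)) p j   ≈⟨ lincomb-scaled-difference u λs μs p j ⟩
        u * (lincomb λs p j - lincomb μs p j)   ≈⟨ *-congˡ (x≈y⇒x∙y⁻¹≈ε (same j)) ⟩
        u * 0#                                  ≈⟨ zeroʳ u ⟩
        0#                                      ∎)

  ≋-split : ∀ k {l} {p q : Pt (k +ℕ l)} →
         (∀ i → p (i ↑ˡ l) ≈ q (i ↑ˡ l)) → (∀ i → p (k ↑ʳ i) ≈ q (k ↑ʳ i)) → p ≋ q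
  ≋-split k {l} {p} {q} left right i =
    ≡.subst (λ i → p i ≈ q i) (join-splitAt k l i) (by-part (splitAt k i))
    where
    by-part : ∀ x → p (join k l x) ≈ q (join k l x)
    by-part (inj₁ x) = left x
    by-part (inj₂ y) = right y

  module _ {m n s r : ℕ} (v : Vector (Pt m) s) (w : Vector (Pt n) r) where

    xCoord : Fin m → Fin (m +ℕ n +ℕ 1)
    xCoord j = (j ↑ˡ n) ↑ˡ 1

    zCoord : Fin (m +ℕ n +ℕ 1)
    zCoord = (m +ℕ n) ↑ʳ zero

    lincomb-join-xCoord : ∀ (Λ : Vector Carrier (s +ℕ r)) j →
      lincomb Λ (joinVerts v w) (xCoord j) ≈ lincomb (take s Λ) v j
    lincomb-join-xCoord Λ j = begin
      lincomb Λ (joinVerts v w) (xCoord j)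
        ≈⟨ lincomb-++ Λ (map (embL n) v) (map (embR m) w) (xCoord j) ⟩
      lincomb (take s Λ) (map (embL n) v) (xCoord j) + lincomb (drop s Λ) (map (embR m) w) (xCoord j)
        ≈⟨ +-cong (sum-cong-≋ (λ i → *-congˡ (embL-x i)))
                  (lincomb-const (drop s Λ) (map (embR m) w) (xCoord j) 0# embR-x) ⟩
      lincomb (take s Λ) v j + ∑ (drop s Λ) * 0#
        ≈⟨ trans (+-congˡ (zeroʳ _)) (+-identityʳ _) ⟩
      lincomb (take s Λ) v j ∎
      where
      embL-x : ∀ i → embL n (v i) (xCoord j) ≈ v i j
      embL-x i = reflexive (≡.trans (lookup-++ˡ (v i ++ replicate n 0#) _ (j ↑ˡ n))
                              (lookup-++ˡ (v i) _ j))
      embR-x : ∀ i → embR m (w i) (xCoord j) ≈ 0#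
      embR-x i = reflexive (≡.trans (lookup-++ˡ (replicate m 0# ++ w i) _ (j ↑ˡ n))
                              (lookup-++ˡ (replicate m 0#) (w i) j))

    lincomb-join-zCoord : ∀ (Λ : Vector Carrier (s +ℕ r)) →
      lincomb Λ (joinVerts v w) zCoord ≈ ∑ (drop s Λ)
    lincomb-join-zCoord Λ = begin
      lincomb Λ (joinVerts v w) zCoord
        ≈⟨ lincomb-++ Λ (map (embL n) v) (map (embR m) w) zCoord ⟩
      lincomb (take s Λ) (map (embL n) v) zCoord + lincomb (drop s Λ) (map (embR m) w) zCoord
        ≈⟨ +-cong (lincomb-const (take s Λ) (map (embL n) v) zCoord 0# (λ i → reflexive (lookup-++ʳ (v i ++ replicate n 0#) _ zero)))
                  (lincomb-const (drop s Λ) (map (embR m) w) zCoord 1# (λ i → reflexive (lookup-++ʳ (replicate m 0# ++ w i) _ zero))) ⟩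
      ∑ (take s Λ) * 0# + ∑ (drop s Λ) * 1#
        ≈⟨ trans (+-cong (zeroʳ _) (*-identityʳ _)) (+-identityˡ _) ⟩
      ∑ (drop s Λ) ∎

    join-injectiveOn-aff : ¬ (0v ∈aff v) → InjectiveOn (_∈aff joinVerts v w) (φ m n)
    join-injectiveOn-aff 0∉aff-v {p} {q} (Λ , ∑Λ≈1 , p≋) (Λ′ , ∑Λ′≈1 , q≋) φp≋φq =
      ≋-split (m +ℕ n) φp≋φq λ { zero → z-agree }
      where
      x-agree : ∀ j → lincomb (take s Λ) v j ≈ lincomb (take s Λ′) v j
      x-agree j = begin
        lincomb (take s Λ) v j                  ≈⟨ sym (lincomb-join-xCoord Λ j) ⟩
        lincomb Λ (joinVerts v w) (xCoord j)    ≈⟨ sym (p≋ (xCoord j)) ⟩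
        p (xCoord j)                            ≈⟨ φp≋φq (j ↑ˡ n) ⟩
        q (xCoord j)                            ≈⟨ q≋ (xCoord j) ⟩
        lincomb Λ′ (joinVerts v w) (xCoord j)   ≈⟨ lincomb-join-xCoord Λ′ j ⟩
        lincomb (take s Λ′) v j                 ∎

      weight-on-S-agrees : ∑ (drop s Λ) ≈ ∑ (drop s Λ′)
      weight-on-S-agrees = ∙-cancelˡ (∑ (take s Λ)) _ _ (begin
        ∑ (take s Λ) + ∑ (drop s Λ)     ≈⟨ sym (∑-++ s Λ) ⟩
        ∑ Λ                             ≈⟨ trans ∑Λ≈1 (sym ∑Λ′≈1) ⟩
        ∑ Λ′                            ≈⟨ ∑-++ s Λ′ ⟩
        ∑ (take s Λ′) + ∑ (drop s Λ′)   ≈⟨ +-congʳ (sym weight-on-R-agrees) ⟩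
        ∑ (take s Λ) + ∑ (drop s Λ′)    ∎)
        where
        weight-on-R-agrees : ∑ (take s Λ) ≈ ∑ (take s Λ′)
        weight-on-R-agrees = 0∉aff⇒lincomb-determines-∑ (take s Λ) (take s Λ′) 0∉aff-v x-agree

      z-agree : p zCoord ≈ q zCoord
      z-agree = begin
        p zCoord                          ≈⟨ p≋ zCoord ⟩
        lincomb Λ (joinVerts v w) zCoord  ≈⟨ lincomb-join-zCoord Λ ⟩
        ∑ (drop s Λ)                      ≈⟨ weight-on-S-agrees ⟩
        ∑ (drop s Λ′)                     ≈⟨ sym (lincomb-join-zCoord Λ′) ⟩
        lincomb Λ′ (joinVerts v w) zCoord ≈⟨ sym (q≋ zCoord) ⟩
        q zCoord                          ∎

  ∈conv⇒∈aff : ∀ {s k} {x : Pt k} {p : Vector (Pt k) s} → x ∈conv p → x ∈aff p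
  ∈conv⇒∈aff (λs , _ , ∑λ≈1 , x≋) = λs , ∑λ≈1 , x≋

-- Only the hypothesis 0 ∉ aff(R) is needed.
lemma3p8 : ∀ {c ℓ₁ ℓ₂ ℓ₃} (F : OrderedHeytingField c ℓ₁ ℓ₂ ℓ₃) →
    let open Geometry F in
    (m n s r : ℕ) (v : Vector (Pt m) s) (w : Vector (Pt n) r) →
    ¬ (0v ∈aff v) → ¬ (0v ∈aff w) →
    InjectiveOn (λ p → p ∈aff joinVerts v w) (φ m n)
    × InjectiveOn (λ p → p ∈conv joinVerts v w) (φ m n)
lemma3p8 F m n s r v w 0∉aff-v _ =
  injective-aff , λ p∈ q∈ → injective-aff (∈conv⇒∈aff p∈) (∈conv⇒∈aff q∈)
  where
  open Geometry F
  open JoinProjection F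
  injective-aff : InjectiveOn (_∈aff joinVerts v w) (φ m n)
  injective-aff = join-injectiveOn-aff v w 0∉aff-v
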